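{- Let $\alpha\in\mathcal{O}_K$ be such that $\operatorname{N}_{K/\mathbb{Q}}(\alpha)$ is neither the square of an integer nor $3$ times the square of an integer. Then for $\zeta\in\boldsymbol\mu_6$ we have $\operatorname{Tr}_{K/\mathbb{Q}}(\zeta\alpha)=\operatorname{Tr}_{K/\mathbb{Q}}(\alpha)$ if and only if $\zeta=1$.
   Context: $K=\mathbb{Q}(\sqrt{ -3})$, $\mathcal{O}_K=\mathbb{Z}[\omega]$ with $\omega=\frac{1+\sqrt{ -3}}{2}$, and $\boldsymbol\mu_6$ is the group of sixth roots of unity in $K$. -}

module Defs where

open import Data.Integer using (ℤ; +_; _+_; _-_; _*_)
open import Data.Product using (Σ; _×_; _,_)
open import Relation.Binary.PropositionalEquality using (_≡_)

-- Elements of O_K = ℤ[ω], ω = (1 + √-3)/2, written a + bω as the pair (a , b).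
-- ω satisfies ω² = ω - 1.
record 𝒪K : Set where
  constructor _+_ω
  field
    re : ℤ
    om : ℤ
open 𝒪K public

one : 𝒪K
one = (+ 1) + (+ 0) ω

_·_ : 𝒪K → 𝒪K → 𝒪K
(a + b ω) · (c + d ω) = (a * c - b * d) + (a * d + b * c + b * d) ω

_^6 : 𝒪K → 𝒪K
x ^6 = let x2 = x · x in (x2 · x2) · x2

-- N_{K/ℚ}(a + bω) = (a + bω)(a + bω̄) = a² + ab + b²
norm : 𝒪K → ℤ
norm (a + b ω) = a * a + a * b + b * b

-- Tr_{K/ℚ}(a + bω) = 2a + b   (since ω + ω̄ = 1)
trace : 𝒪K → ℤ
trace (a + b ω) = (+ 2) * a + b

-- μ₆ : sixth roots of unity in K (all lie in O_K)
μ₆ : 𝒪K → Set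
μ₆ ζ = ζ ^6 ≡ one

IsSquare : ℤ → Set
IsSquare n = Σ ℤ (λ m → n ≡ m * m)

IsThreeTimesSquare : ℤ → Set
IsThreeTimesSquare n = Σ ℤ (λ m → n ≡ (+ 3) * (m * m))

{-# OPTIONS --safe #-}
-- A sixth root of unity has norm 1, so it is one of ±1, ±ω, ±ω². If Tr(ζα) = Tr(α),
-- then β = (ζ − 1)α has trace 0, and an element x + yω of trace 2x + y = 0 has norm
-- N(β) = 3x². Hence N(ζ − 1)·N(α) = 3x², and for ζ ≠ 1 the factor N(ζ − 1) is 1, 3 or 4,
-- which makes N(α) three times a square, a square, or (ζ = −1, where x = −2a) 3a².
module Submission where

open import Defs
open import Relation.Nullary using (¬_)
open import Relation.Binary.PropositionalEquality
  using (_≡_; refl; sym; trans; cong; cong₂; subst; module ≡-Reasoning)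
open import Function.Bundles using (_⇔_; mk⇔)
open import Function.Base using (id; _∘_)
open import Data.Nat as ℕ using (zero; suc; s≤s; z≤n)
open import Data.Nat.Properties using (m≤n+m; *-mono-≤; *-monoʳ-≤; ≤-trans)
open import Data.Integer using (+_; -[1+_]; 0ℤ; _+_; _-_; -_; _*_; _≤_; ∣_∣; +≤+)
open import Data.Integer.Properties
  using ( +-injective; pos-+; pos-*; +-identityʳ; *-identityˡ
        ; *-cancelˡ-≡; *-cancelˡ-≤-pos; i≡j⇒i-j≡0 )
open import Data.Integer.Tactic.RingSolver using (solve-∀)
open import Data.Sum using (_⊎_; inj₁; inj₂; [_,_])
open import Data.Product using (_,_)
open import Data.Empty using (⊥-elim)

_-𝒪_ : 𝒪K → 𝒪K → 𝒪K
(a + b ω) -𝒪 (c + d ω) = (a - c) + (b - d) ω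

-- The ring solver does not unfold definitions, so each `identity` restates its
-- lemma with norm, trace and _·_ written out.
norm-· : ∀ x y → norm (x · y) ≡ norm x * norm y
norm-· (a + b ω) (c + d ω) = identity a b c d
  where
  identity : ∀ a b c d →
    (a * c - b * d) * (a * c - b * d) + (a * c - b * d) * (a * d + b * c + b * d)
      + (a * d + b * c + b * d) * (a * d + b * c + b * d)
    ≡ (a * a + a * b + b * b) * (c * c + c * d + d * d)
  identity = solve-∀

norm-swap : ∀ c d → norm (d + c ω) ≡ norm (c + d ω)
norm-swap = identity
  where
  identity : ∀ c d → d * d + d * c + c * c ≡ c * c + c * d + d * d
  identity = solve-∀

four-norm : ∀ x → (+ 4) * norm x ≡ trace x * trace x + (+ 3) * (om x * om x)
four-norm (c + d ω) = identity c d
  where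
  identity : ∀ c d →
    (+ 4) * (c * c + c * d + d * d) ≡ ((+ 2) * c + d) * ((+ 2) * c + d) + (+ 3) * (d * d)
  identity = solve-∀

norm≡3re²+trace : ∀ x → norm x ≡ (+ 3) * (re x * re x) + trace x * (om x - re x)
norm≡3re²+trace (c + d ω) = identity c d
  where
  identity : ∀ c d → c * c + c * d + d * d ≡ (+ 3) * (c * c) + ((+ 2) * c + d) * (d - c)
  identity = solve-∀

trace-·-sub-trace : ∀ ζ α → trace (ζ · α) - trace α ≡ trace ((ζ -𝒪 one) · α)
trace-·-sub-trace (c + d ω) (a + b ω) = identity c d a b
  where
  identity : ∀ c d a b →
    (+ 2) * (c * a - d * b) + (c * b + d * a + d * b) - ((+ 2) * a + b)
    ≡ (+ 2) * ((c - + 1) * a - (d - + 0) * b) + ((c - + 1) * b + (d - + 0) * a + (d - + 0) * b)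
  identity = solve-∀

trace-one-· : ∀ α → trace (one · α) ≡ trace α
trace-one-· (a + b ω) = identity a b
  where
  identity : ∀ a b → (+ 2) * (+ 1 * a - + 0 * b) + (+ 1 * b + + 0 * a + + 0 * b) ≡ (+ 2) * a + b
  identity = solve-∀

square-as-ℕ : ∀ x → x * x ≡ + (∣ x ∣ ℕ.* ∣ x ∣)
square-as-ℕ (+ zero) = refl
square-as-ℕ (+ suc n) = refl
square-as-ℕ -[1+ n ] = refl

form-as-ℕ : ∀ x y →
  x * x + (+ 3) * (y * y) ≡ + (∣ x ∣ ℕ.* ∣ x ∣ ℕ.+ 3 ℕ.* (∣ y ∣ ℕ.* ∣ y ∣))
form-as-ℕ x y = begin
  x * x + (+ 3) * (y * y)  ≡⟨ cong₂ _+_ (square-as-ℕ x) (cong ((+ 3) *_) (square-as-ℕ y)) ⟩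
  + m + (+ 3) * + n        ≡⟨ cong (_+_ (+ m)) (sym (pos-* 3 n)) ⟩
  + m + + (3 ℕ.* n)        ≡⟨ sym (pos-+ m (3 ℕ.* n)) ⟩
  + (m ℕ.+ 3 ℕ.* n)        ∎
  where
  open ≡-Reasoning
  m = ∣ x ∣ ℕ.* ∣ x ∣
  n = ∣ y ∣ ℕ.* ∣ y ∣

four-norm-as-ℕ : ∀ x →
  (+ 4) * norm x ≡ + (∣ trace x ∣ ℕ.* ∣ trace x ∣ ℕ.+ 3 ℕ.* (∣ om x ∣ ℕ.* ∣ om x ∣))
four-norm-as-ℕ x = trans (four-norm x) (form-as-ℕ (trace x) (om x))

0≤norm : ∀ x → 0ℤ ≤ norm x
0≤norm x =
  *-cancelˡ-≤-pos 0ℤ (norm x) (+ 4) (subst (0ℤ ≤_) (sym (four-norm-as-ℕ x)) (+≤+ z≤n))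

3n²≤4⇒n≤1 : ∀ n → 3 ℕ.* (n ℕ.* n) ℕ.≤ 4 → n ℕ.≤ 1
3n²≤4⇒n≤1 zero _ = z≤n
3n²≤4⇒n≤1 (suc zero) _ = s≤s z≤n
3n²≤4⇒n≤1 (suc (suc n)) 3n²≤4 with ≤-trans (*-monoʳ-≤ 3 (*-mono-≤ 2≤n 2≤n)) 3n²≤4
  where 2≤n = s≤s (s≤s (z≤n {n}))
... | s≤s (s≤s (s≤s (s≤s ())))

norm≡1⇒∣om∣≤1 : ∀ x → norm x ≡ + 1 → ∣ om x ∣ ℕ.≤ 1
norm≡1⇒∣om∣≤1 x norm≡1 =
  3n²≤4⇒n≤1 d (subst (3 ℕ.* (d ℕ.* d) ℕ.≤_) form≡4 (m≤n+m (3 ℕ.* (d ℕ.* d)) (t ℕ.* t)))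
  where
  t = ∣ trace x ∣
  d = ∣ om x ∣
  form≡4 : t ℕ.* t ℕ.+ 3 ℕ.* (d ℕ.* d) ≡ 4
  form≡4 = +-injective (trans (sym (four-norm-as-ℕ x)) (cong ((+ 4) *_) norm≡1))

data Unit : 𝒪K → Set where
  1ᵘ   : Unit ((+ 1) + (+ 0) ω)
  ωᵘ   : Unit ((+ 0) + (+ 1) ω)
  ω²ᵘ  : Unit (-[1+ 0 ] + (+ 1) ω)
  -1ᵘ  : Unit (-[1+ 0 ] + (+ 0) ω)
  -ωᵘ  : Unit ((+ 0) + -[1+ 0 ] ω)
  -ω²ᵘ : Unit ((+ 1) + -[1+ 0 ] ω)

bounded-norm≡1⇒unit : ∀ c d → ∣ c ∣ ℕ.≤ 1 → ∣ d ∣ ℕ.≤ 1 →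
  norm (c + d ω) ≡ + 1 → Unit (c + d ω)
bounded-norm≡1⇒unit (+ 0)     (+ 0)     _ _ ()
bounded-norm≡1⇒unit (+ 0)     (+ 1)     _ _ _  = ωᵘ
bounded-norm≡1⇒unit (+ 0)     -[1+ 0 ]  _ _ _  = -ωᵘ
bounded-norm≡1⇒unit (+ 1)     (+ 0)     _ _ _  = 1ᵘ
bounded-norm≡1⇒unit (+ 1)     (+ 1)     _ _ ()
bounded-norm≡1⇒unit (+ 1)     -[1+ 0 ]  _ _ _  = -ω²ᵘ
bounded-norm≡1⇒unit -[1+ 0 ]  (+ 0)     _ _ _  = -1ᵘ
bounded-norm≡1⇒unit -[1+ 0 ]  (+ 1)     _ _ _  = ω²ᵘ
bounded-norm≡1⇒unit -[1+ 0 ]  -[1+ 0 ]  _ _ ()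
bounded-norm≡1⇒unit (+ suc (suc _)) _ (s≤s ()) _ _
bounded-norm≡1⇒unit -[1+ suc _ ]    _ (s≤s ()) _ _
bounded-norm≡1⇒unit _ (+ suc (suc _)) _ (s≤s ()) _
bounded-norm≡1⇒unit _ -[1+ suc _ ]    _ (s≤s ()) _

norm≡1⇒unit : ∀ x → norm x ≡ + 1 → Unit x
norm≡1⇒unit (c + d ω) norm≡1 =
  bounded-norm≡1⇒unit c d
    (norm≡1⇒∣om∣≤1 (d + c ω) (trans (norm-swap c d) norm≡1))
    (norm≡1⇒∣om∣≤1 (c + d ω) norm≡1)
    norm≡1

nonneg-sixth-root-of-1 : ∀ n → 0ℤ ≤ n → ((n * n) * (n * n)) * (n * n) ≡ + 1 → n ≡ + 1
nonneg-sixth-root-of-1 (+ 0)           _ ()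
nonneg-sixth-root-of-1 (+ 1)           _ _ = refl
nonneg-sixth-root-of-1 (+ suc (suc _)) _ ()

μ₆⇒unit : ∀ ζ → μ₆ ζ → Unit ζ
μ₆⇒unit ζ ζ⁶≡1 = norm≡1⇒unit ζ (nonneg-sixth-root-of-1 N (0≤norm ζ) N⁶≡1)
  where
  open ≡-Reasoning
  ζ² = ζ · ζ
  N = norm ζ
  N⁶≡1 : ((N * N) * (N * N)) * (N * N) ≡ + 1
  N⁶≡1 = begin
    ((N * N) * (N * N)) * (N * N)         ≡⟨ cong₂ (λ u v → (u * u) * v) (sym (norm-· ζ ζ)) (sym (norm-· ζ ζ)) ⟩
    (norm ζ² * norm ζ²) * norm ζ²         ≡⟨ cong (_* norm ζ²) (sym (norm-· ζ² ζ²)) ⟩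
    norm (ζ² · ζ²) * norm ζ²              ≡⟨ sym (norm-· (ζ² · ζ²) ζ²) ⟩
    norm (ζ ^6)                           ≡⟨ cong norm ζ⁶≡1 ⟩
    + 1                                   ∎

trace-fixed⇒norm[ζ-1]*norm≡3x² : ∀ ζ α → trace (ζ · α) ≡ trace α →
  norm (ζ -𝒪 one) * norm α ≡ (+ 3) * (re ((ζ -𝒪 one) · α) * re ((ζ -𝒪 one) · α))
trace-fixed⇒norm[ζ-1]*norm≡3x² ζ α fixed = begin
  norm δ * norm α                ≡⟨ sym (norm-· δ α) ⟩
  norm β                         ≡⟨ norm≡3re²+trace β ⟩
  3x² + trace β * (om β - re β)  ≡⟨ cong (λ t → 3x² + t * (om β - re β)) trace≡0 ⟩
  3x² + 0ℤ                       ≡⟨ +-identityʳ 3x² ⟩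
  3x²                            ∎
  where
  open ≡-Reasoning
  δ = ζ -𝒪 one
  β = δ · α
  3x² = (+ 3) * (re β * re β)
  trace≡0 : trace β ≡ 0ℤ
  trace≡0 = trans (sym (trace-·-sub-trace ζ α)) (i≡j⇒i-j≡0 fixed)

trace-fixed∧norm[ζ-1]≡1⇒3square : ∀ ζ α → trace (ζ · α) ≡ trace α → norm (ζ -𝒪 one) ≡ + 1 →
  IsThreeTimesSquare (norm α)
trace-fixed∧norm[ζ-1]≡1⇒3square ζ α fixed norm≡1 = x , (begin
  norm α                      ≡⟨ sym (*-identityˡ (norm α)) ⟩
  + 1 * norm α                ≡⟨ cong (_* norm α) (sym norm≡1) ⟩
  norm (ζ -𝒪 one) * norm α    ≡⟨ trace-fixed⇒norm[ζ-1]*norm≡3x² ζ α fixed ⟩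
  (+ 3) * (x * x)             ∎)
  where
  open ≡-Reasoning
  x = re ((ζ -𝒪 one) · α)

trace-fixed∧norm[ζ-1]≡3⇒square : ∀ ζ α → trace (ζ · α) ≡ trace α → norm (ζ -𝒪 one) ≡ + 3 →
  IsSquare (norm α)
trace-fixed∧norm[ζ-1]≡3⇒square ζ α fixed norm≡3 =
  x , *-cancelˡ-≡ (+ 3) (norm α) (x * x) (begin
  (+ 3) * norm α              ≡⟨ cong (_* norm α) (sym norm≡3) ⟩
  norm (ζ -𝒪 one) * norm α    ≡⟨ trace-fixed⇒norm[ζ-1]*norm≡3x² ζ α fixed ⟩
  (+ 3) * (x * x)             ∎)
  where
  open ≡-Reasoning
  x = re ((ζ -𝒪 one) · α)

-- Here N(ζ − 1) = 4, but x = −2a is visibly even, so no parity argument is needed.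
trace-fixed-by-minus-one⇒3square : ∀ α → trace ((-[1+ 0 ] + (+ 0) ω) · α) ≡ trace α →
  IsThreeTimesSquare (norm α)
trace-fixed-by-minus-one⇒3square α@(a + b ω) fixed =
  a , *-cancelˡ-≡ (+ 4) (norm α) ((+ 3) * (a * a)) (begin
  (+ 4) * norm α                   ≡⟨ trace-fixed⇒norm[ζ-1]*norm≡3x² (-[1+ 0 ] + (+ 0) ω) α fixed ⟩
  (+ 3) * (x * x)                  ≡⟨ identity a b ⟩
  (+ 4) * ((+ 3) * (a * a))        ∎)
  where
  open ≡-Reasoning
  x = - (+ 2) * a - + 0 * b
  identity : ∀ a b → (+ 3) * ((- (+ 2) * a - + 0 * b) * (- (+ 2) * a - + 0 * b)) ≡ (+ 4) * ((+ 3) * (a * a))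
  identity = solve-∀

trace-fixed-by-unit : ∀ α {ζ} → Unit ζ → trace (ζ · α) ≡ trace α →
  ζ ≡ one ⊎ IsSquare (norm α) ⊎ IsThreeTimesSquare (norm α)
trace-fixed-by-unit α 1ᵘ        _     = inj₁ refl
trace-fixed-by-unit α {ζ} ωᵘ   fixed = inj₂ (inj₂ (trace-fixed∧norm[ζ-1]≡1⇒3square ζ α fixed refl))
trace-fixed-by-unit α {ζ} -ω²ᵘ fixed = inj₂ (inj₂ (trace-fixed∧norm[ζ-1]≡1⇒3square ζ α fixed refl))
trace-fixed-by-unit α {ζ} ω²ᵘ  fixed = inj₂ (inj₁ (trace-fixed∧norm[ζ-1]≡3⇒square ζ α fixed refl))
trace-fixed-by-unit α {ζ} -ωᵘ  fixed = inj₂ (inj₁ (trace-fixed∧norm[ζ-1]≡3⇒square ζ α fixed refl))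
trace-fixed-by-unit α -1ᵘ       fixed = inj₂ (inj₂ (trace-fixed-by-minus-one⇒3square α fixed))

lemma21 : (α : 𝒪K) → ¬ IsSquare (norm α) → ¬ IsThreeTimesSquare (norm α) →
          (ζ : 𝒪K) → μ₆ ζ → (trace (ζ · α) ≡ trace α) ⇔ (ζ ≡ one)
lemma21 α not-square not-3square ζ ζ∈μ₆ = mk⇔ fixed⇒one one⇒fixed
  where
  fixed⇒one : trace (ζ · α) ≡ trace α → ζ ≡ one
  fixed⇒one fixed =
    [ id , ⊥-elim ∘ [ not-square , not-3square ] ] (trace-fixed-by-unit α (μ₆⇒unit ζ ζ∈μ₆) fixed)
  one⇒fixed : ζ ≡ one → trace (ζ · α) ≡ trace α
  one⇒fixed refl = trace-one-· α
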